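{- Let $G=\mathbb{Z}_{n_1}\times\mathbb{Z}_{n_2}\times\cdots\times\mathbb{Z}_{n_k}=\{g_0,g_1,\ldots,g_{n-1}\}$ be an Abelian group of odd order $n$, ordered lexicographically. If $s$ is a positive integer with $\gcd(s+1,n)=1$, then for every $c,d\in\{0,1,\ldots,n-1\}$ the map $\phi:G\to G$ given by $\phi(g_i)=g_{i+c}+g_{si+d}$ (indices taken modulo $n$) is injective.
   Context: The elements of $G=\mathbb{Z}_{n_1}\times\cdots\times\mathbb{Z}_{n_k}$ are tuples $(i_1,\dots,i_k)$ with $i_l\in\{0,\dots,n_l-1\}$. The group is ordered lexicographically, $G=\{g_0,\dots,g_{n-1}\}$, meaning that $g_i=(i_1,\dots,i_k)$ precedes $g_j=(j_1,\dots,j_k)$ (i.e. $i<j$) if and only if there is some $l$ with $i_l<j_l$ and $i_m=j_m$ for all $m<l$. -}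

module Defs where

open import Data.Nat using (ℕ; zero; suc; _+_; _*_; _<_)
open import Data.Nat.DivMod using (_%_; _/_)
open import Data.List using (List; []; _∷_)
open import Data.Nat.ListAction using (product)

-- Both only ever get applied with
-- m ≥ 1 under the hypotheses of the lemma (the group order is odd, hence
-- every factor n_l is nonzero); for m = 0 they are given harmless values.
modN : ℕ → ℕ → ℕ
modN zero    a = a
modN (suc m) a = a % suc m

divN : ℕ → ℕ → ℕ
divN zero    a = a
divN (suc m) a = a / suc m

-- The group G = ℤ_{n_1} × ⋯ × ℤ_{n_k}, given by the list ns = [n_1,…,n_k].
-- An element is a tuple (i_1,…,i_k), represented as a list of naturals
-- with i_l ∈ {0,…,n_l-1}.
Elt : Set
Elt = List ℕ

order : List ℕ → ℕ
order ns = product ns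

addG : List ℕ → Elt → Elt → Elt
addG []       _        _        = []
addG (m ∷ ms) []       _        = []
addG (m ∷ ms) (_ ∷ _)  []       = []
addG (m ∷ ms) (a ∷ as) (b ∷ bs) = modN m (a + b) ∷ addG ms as bs

-- Lexicographic enumeration g_0, g_1, …, g_{n-1} of G: g_i is the i-th
-- element in lexicographic order, i.e. the mixed-radix expansion of i with
-- the first coordinate most significant:
--   i_1 = (i / (n_2⋯n_k)) mod n_1,  and (i_2,…,i_k) = g'_{i mod (n_2⋯n_k)}.
g : List ℕ → ℕ → Elt
g []       i = []
g (m ∷ ms) i = modN m (divN (order ms) i) ∷ g ms (modN (order ms) i)

φ : List ℕ → (s c d : ℕ) → ℕ → Elt
φ ns s c d i = addG ns (g ns (modN (order ns) (i + c)))
                       (g ns (modN (order ns) (s * i + d)))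

module Submission where

-- Write N = n₂⋯n_k and G = ℤ_{n₁} × G'.  The lexicographic
-- enumeration is the mixed-radix expansion of the index: the leading
-- coordinate of g_x is (x / N) mod n₁ and the remaining ones form g'_{x mod N}.
-- We prove, by induction on the list of factors, the more general fact that
--   x ↦ g_{a x + b} + g_{a' x + b'}
-- determines x modulo n whenever a + a' is coprime to n (φ is a = 1, a' = s).
-- The tail coordinates determine x mod N by induction.  In the leading
-- coordinate, (a x + b)/N + (a' x + b')/N equals a term depending only on
-- x mod N plus the carry (a + a')·(x / N); cancelling that term and then the
-- unit a + a' modulo n₁ recovers (x / N) mod n₁, and the two digits together
-- give x mod n₁N.

open import Defs
open import Data.Nat using (ℕ; suc; NonZero; _+_; _*_; _∸_; _<_; _≤_)
open import Data.Nat.Properties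
open import Data.Nat.DivMod
open import Data.Nat.Divisibility using (_∣_; divides; n∣m*n; m∣m*n; ∣-trans)
open import Data.Nat.Coprimality as Coprime using (Coprime; coprime-divisor; gcd≡1⇒coprime)
open import Data.Nat.GCD using (gcd)
open import Data.Nat.Tactic.RingSolver using (solve-∀)
open import Data.List using (List; []; _∷_)
open import Data.List.Properties using (∷-injective)
open import Data.Product using (_,_; proj₁; proj₂)
open import Data.Sum using (inj₁; inj₂)
open import Function using (_∘_)
open import Relation.Binary.PropositionalEquality
open ≡-Reasoning

modN≡% : ∀ m .{{_ : NonZero m}} x → modN m x ≡ x % m
modN≡% (suc m) x = refl

divN≡/ : ∀ m .{{_ : NonZero m}} x → divN m x ≡ x / m
divN≡/ (suc m) x = refl

%≡⇒∣∸ : ∀ {a b} m .{{_ : NonZero m}} → a % m ≡ b % m → m ∣ b ∸ a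
%≡⇒∣∸ {a} {b} m a%≡b% = divides (b / m ∸ a / m) (begin
  b ∸ a                                   ≡⟨ cong₂ _∸_ (m≡m%n+[m/n]*n b m) (m≡m%n+[m/n]*n a m) ⟩
  (b % m + b / m * m) ∸ (a % m + a / m * m) ≡⟨ cong (λ r → (b % m + b / m * m) ∸ (r + a / m * m)) a%≡b% ⟩
  (b % m + b / m * m) ∸ (b % m + a / m * m) ≡⟨ [m+n]∸[m+o]≡n∸o (b % m) _ _ ⟩
  b / m * m ∸ a / m * m                   ≡⟨ *-distribʳ-∸ m (b / m) (a / m) ⟨
  (b / m ∸ a / m) * m                     ∎)

-- Conversely, numbers whose differences in both orders are multiples of m
-- have equal residues (one of the two differences is the true one).
∣∸⇒%≡ : ∀ {a b} m .{{_ : NonZero m}} → m ∣ b ∸ a → m ∣ a ∸ b → a % m ≡ b % m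
∣∸⇒%≡ {a} {b} m m∣b∸a m∣a∸b with ≤-total a b
... | inj₁ a≤b = sym (trans (cong (_% m) (sym (m+[n∸m]≡n a≤b))) (%-remove-+ʳ a m∣b∸a))
... | inj₂ b≤a = trans (cong (_% m) (sym (m+[n∸m]≡n b≤a))) (%-remove-+ʳ b m∣a∸b)

+-cancelˡ-% : ∀ h {x y} m .{{_ : NonZero m}} → (h + x) % m ≡ (h + y) % m → x % m ≡ y % m
+-cancelˡ-% h {x} {y} m eq = ∣∸⇒%≡ m (cancel (%≡⇒∣∸ m eq)) (cancel (%≡⇒∣∸ m (sym eq)))
  where
  cancel : ∀ {u v} → m ∣ (h + u) ∸ (h + v) → m ∣ u ∸ v
  cancel {u} {v} = subst (m ∣_) ([m+n]∸[m+o]≡n∸o h u v)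

*-cancelˡ-% : ∀ k {x y} m .{{_ : NonZero m}} → Coprime k m →
              (k * x) % m ≡ (k * y) % m → x % m ≡ y % m
*-cancelˡ-% k {x} {y} m k⊥m eq = ∣∸⇒%≡ m (cancel (%≡⇒∣∸ m eq)) (cancel (%≡⇒∣∸ m (sym eq)))
  where
  cancel : ∀ {u v} → m ∣ k * u ∸ k * v → m ∣ u ∸ v
  cancel {u} {v} = coprime-divisor (Coprime.sym k⊥m) ∘ subst (m ∣_) (sym (*-distribˡ-∸ k u v))

/-affine : ∀ N .{{_ : NonZero N}} a b x → (a * x + b) / N ≡ (a * (x % N) + b) / N + a * (x / N)
/-affine N a b x = begin
  (a * x + b) / N                              ≡⟨ cong (λ z → (a * z + b) / N) (m≡m%n+[m/n]*n x N) ⟩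
  (a * (x % N + x / N * N) + b) / N            ≡⟨ cong (_/ N) (regroup a (x % N) (x / N) b N) ⟩
  (a * (x / N) * N + (a * (x % N) + b)) / N    ≡⟨ +-distrib-/-∣ˡ _ (n∣m*n (a * (x / N))) ⟩
  a * (x / N) * N / N + (a * (x % N) + b) / N  ≡⟨ cong (_+ (a * (x % N) + b) / N) (m*n/n≡m _ N) ⟩
  a * (x / N) + (a * (x % N) + b) / N          ≡⟨ +-comm (a * (x / N)) _ ⟩
  (a * (x % N) + b) / N + a * (x / N)          ∎
  where
  regroup : ∀ a r q b N → a * (r + q * N) + b ≡ a * q * N + (a * r + b)
  regroup = solve-∀

%-mixed-radix : ∀ m N .{{_ : NonZero m}} .{{_ : NonZero N}} {{_ : NonZero (m * N)}} x →
                x % (m * N) ≡ x % N + x / N % m * N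
%-mixed-radix m N x = trans (m≡m%n+[m/n]*n (x % (m * N)) N)
  (cong₂ (λ r q → r + q * N) (m∣n⇒o%n%m≡o%m N (m * N) x (n∣m*n m)) (m%[n*o]/o≡m/o%n x m N))

g-% : ∀ ns {{_ : NonZero (order ns)}} x → g ns (x % order ns) ≡ g ns x
g-% []       x = refl
g-% (m ∷ ms) x = cong₂ _∷_ leading rest
  where
  N = order ms
  instance
    m≢0 : NonZero m
    m≢0 = m*n≢0⇒m≢0 m
    N≢0 : NonZero N
    N≢0 = m*n≢0⇒n≢0 m
  leading : modN m (divN N (x % (m * N))) ≡ modN m (divN N x)
  leading = begin
    modN m (divN N (x % (m * N))) ≡⟨ trans (modN≡% m _) (cong (_% m) (divN≡/ N _)) ⟩
    x % (m * N) / N % m           ≡⟨ cong (_% m) (m%[n*o]/o≡m/o%n x m N) ⟩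
    x / N % m % m                 ≡⟨ m%n%n≡m%n (x / N) m ⟩
    x / N % m                     ≡⟨ sym (trans (modN≡% m _) (cong (_% m) (divN≡/ N x))) ⟩
    modN m (divN N x)             ∎
  rest : g ms (modN N (x % (m * N))) ≡ g ms (modN N x)
  rest = cong (g ms) (begin
    modN N (x % (m * N)) ≡⟨ modN≡% N _ ⟩
    x % (m * N) % N      ≡⟨ m∣n⇒o%n%m≡o%m N (m * N) x (n∣m*n m) ⟩
    x % N                ≡⟨ sym (modN≡% N x) ⟩
    modN N x             ∎)

sumG : List ℕ → ℕ → ℕ → Elt
sumG ns u v = addG ns (g ns u) (g ns v)

sumG-∷ : ∀ m ms .{{_ : NonZero m}} {{_ : NonZero (order ms)}} u v →
         sumG (m ∷ ms) u v ≡ (u / order ms + v / order ms) % m ∷ sumG ms u v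
sumG-∷ m ms u v = cong₂ _∷_ leading (cong₂ (addG ms) (tail u) (tail v))
  where
  N = order ms
  digit : ∀ x → modN m (divN N x) ≡ x / N % m
  digit x = trans (modN≡% m _) (cong (_% m) (divN≡/ N x))
  tail : ∀ x → g ms (modN N x) ≡ g ms x
  tail x = trans (cong (g ms) (modN≡% N x)) (g-% ms x)
  leading : modN m (modN m (divN N u) + modN m (divN N v)) ≡ (u / N + v / N) % m
  leading = begin
    modN m (modN m (divN N u) + modN m (divN N v)) ≡⟨ modN≡% m _ ⟩
    (modN m (divN N u) + modN m (divN N v)) % m    ≡⟨ cong₂ (λ p q → (p + q) % m) (digit u) (digit v) ⟩
    (u / N % m + v / N % m) % m                    ≡⟨ %-distribˡ-+ (u / N) (v / N) m ⟨
    (u / N + v / N) % m                            ∎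

Φ : List ℕ → (a b a' b' : ℕ) → ℕ → Elt
Φ ns a b a' b' x = sumG ns (a * x + b) (a' * x + b')

columnSum : (N : ℕ) .{{_ : NonZero N}} (a b a' b' x : ℕ) → ℕ
columnSum N a b a' b' x = (a * x + b) / N + (a' * x + b') / N

columnSum-carry : ∀ N .{{_ : NonZero N}} a b a' b' x →
                  columnSum N a b a' b' x ≡ columnSum N a b a' b' (x % N) + (a + a') * (x / N)
columnSum-carry N a b a' b' x = trans (cong₂ _+_ (/-affine N a b x) (/-affine N a' b' x))
  (collect ((a * (x % N) + b) / N) ((a' * (x % N) + b') / N) a a' (x / N))
  where
  collect : ∀ p p' a a' q → (p + a * q) + (p' + a' * q) ≡ (p + p') + (a + a') * q
  collect = solve-∀

coprime-∣ʳ : ∀ {k n d} → Coprime k n → d ∣ n → Coprime k d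
coprime-∣ʳ k⊥n d∣n (e∣k , e∣d) = k⊥n (e∣k , ∣-trans e∣d d∣n)

-- Induction on the factors: the tail gives the low
-- digit x mod N, the leading coordinate then gives the digit (x / N) mod m.
Φ-injective : ∀ ns {{_ : NonZero (order ns)}} a b a' b' → Coprime (a + a') (order ns) →
              ∀ x y → Φ ns a b a' b' x ≡ Φ ns a b a' b' y → x % order ns ≡ y % order ns
Φ-injective []       a b a' b' _      x y _  = trans (n%1≡0 x) (sym (n%1≡0 y))
Φ-injective (m ∷ ms) a b a' b' a+a'⊥n x y eq = begin
  x % (m * N)              ≡⟨ %-mixed-radix m N x ⟩
  x % N + x / N % m * N    ≡⟨ cong₂ (λ r q → r + q * N) low high ⟩
  y % N + y / N % m * N    ≡⟨ %-mixed-radix m N y ⟨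
  y % (m * N)              ∎
  where
  N = order ms
  instance
    m≢0 : NonZero m
    m≢0 = m*n≢0⇒m≢0 m
    N≢0 : NonZero N
    N≢0 = m*n≢0⇒n≢0 m
  col : ℕ → ℕ
  col = columnSum N a b a' b'
  k = a + a'
  eq-∷ : col x % m ∷ Φ ms a b a' b' x ≡ col y % m ∷ Φ ms a b a' b' y
  eq-∷ = trans (sym (sumG-∷ m ms _ _)) (trans eq (sumG-∷ m ms _ _))
  leading : col x % m ≡ col y % m
  leading = proj₁ (∷-injective eq-∷)
  tail : Φ ms a b a' b' x ≡ Φ ms a b a' b' y
  tail = proj₂ (∷-injective eq-∷)
  low : x % N ≡ y % N
  low = Φ-injective ms a b a' b' (coprime-∣ʳ a+a'⊥n (n∣m*n m)) x y tail
  high : x / N % m ≡ y / N % m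
  high = *-cancelˡ-% k m (coprime-∣ʳ a+a'⊥n (m∣m*n N)) (+-cancelˡ-% (col (y % N)) m (begin
    (col (y % N) + k * (x / N)) % m  ≡⟨ cong (λ r → (col r + k * (x / N)) % m) low ⟨
    (col (x % N) + k * (x / N)) % m  ≡⟨ cong (_% m) (columnSum-carry N a b a' b' x) ⟨
    col x % m                        ≡⟨ leading ⟩
    col y % m                        ≡⟨ cong (_% m) (columnSum-carry N a b a' b' y) ⟩
    (col (y % N) + k * (y / N)) % m  ∎))

odd⇒NonZero : ∀ n → n % 2 ≡ 1 → NonZero n
odd⇒NonZero (suc n) _ = _

lemma2p1 : (ns : List ℕ) → order ns % 2 ≡ 1 →
           (s : ℕ) → 1 ≤ s → gcd (s + 1) (order ns) ≡ 1 →
           (c d : ℕ) → c < order ns → d < order ns →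
           (i j : ℕ) → i < order ns → j < order ns →
           φ ns s c d i ≡ φ ns s c d j → i ≡ j
lemma2p1 ns odd s _ gcd≡1 c d _ _ i j i<n j<n eq = begin
  i       ≡⟨ m<n⇒m%n≡m i<n ⟨
  i % n   ≡⟨ Φ-injective ns 1 c s d 1+s⊥n i j (trans (sym (φ≡Φ i)) (trans eq (φ≡Φ j))) ⟩
  j % n   ≡⟨ m<n⇒m%n≡m j<n ⟩
  j       ∎
  where
  n = order ns
  instance
    n≢0 : NonZero n
    n≢0 = odd⇒NonZero n odd
  1+s⊥n : Coprime (1 + s) n
  1+s⊥n = subst (λ k → Coprime k n) (+-comm s 1) (gcd≡1⇒coprime gcd≡1)
  reduced : ∀ z → g ns (modN n z) ≡ g ns z
  reduced z = trans (cong (g ns) (modN≡% n z)) (g-% ns z)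
  φ≡Φ : ∀ x → φ ns s c d x ≡ Φ ns 1 c s d x
  φ≡Φ x = cong₂ (addG ns) (trans (reduced (x + c)) (cong (λ z → g ns (z + c)) (sym (*-identityˡ x))))
                          (reduced (s * x + d))
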